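{- Let $(g,f)=(d_{n,k})_{n,k\ge0}$ be a Riordan array with $g(0)=1$. Then, as infinite matrices, $$(g,f)=[g,f]\,\big([1]\oplus(g,f)\big),$$ where $[g,f]$ is the quasi-Riordan array of $g,f$ and $[1]\oplus(g,f)$ is the block-diagonal matrix $\begin{pmatrix}1&0\\0&(g,f)\end{pmatrix}$.
   Context: $\mathbb{K}$ is $\mathbb{R}$ or $\mathbb{C}$. For $g\in\mathbb{K}[[t]]$ with $g(0)=1$ and $f\in\mathbb{K}[[t]]$ with $f(0)=0\ne f'(0)$, the Riordan array $(g,f)=(d_{n,k})_{n,k\ge0}$ is the infinite lower triangular matrix with $d_{n,k}=[t^n]g(t)f(t)^k$ (column $k$ has generating function $gf^k$). The quasi-Riordan array $[g,f]$ is the infinite lower triangular matrix whose $0$th column has generating function $g$ and whose $j$th column, for $j\ge1$, has generating function $t^{j-1}f$; i.e. $[g,f]=(g,f,tf,t^2f,\dots)$. Equivalently, with $f=\sum_{j\ge1}f_jt^j$, $[g,f]$ has first row $(g_0,0,0,\dots)$, and for $n\ge1$ its $n$th row is $(g_n,f_n,f_{n-1},\dots,f_1,0,\dots)$. -}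

module Defs where

open import Level using (Level)
open import Data.Nat using (ℕ; zero; suc; _∸_)
open import Algebra.Bundles using (CommutativeRing)

module Series {c ℓ : Level} (R : CommutativeRing c ℓ) where
  open CommutativeRing R

  PowerSeries : Set c
  PowerSeries = ℕ → Carrier

  Matrix : Set c
  Matrix = ℕ → ℕ → Carrier

  sumBelow : (ℕ → Carrier) → ℕ → Carrier
  sumBelow a zero    = 0#
  sumBelow a (suc n) = sumBelow a n + a n

  _⋆_ : PowerSeries → PowerSeries → PowerSeries
  (a ⋆ b) n = sumBelow (λ i → a i * b (n ∸ i)) (suc n)

  one : PowerSeries
  one zero    = 1#
  one (suc n) = 0#

  pow : PowerSeries → ℕ → PowerSeries
  pow f zero    = one
  pow f (suc k) = f ⋆ pow f k

  shift : ℕ → PowerSeries → PowerSeries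
  shift zero    a n       = a n
  shift (suc j) a zero    = 0#
  shift (suc j) a (suc n) = shift j a n

  riordan : PowerSeries → PowerSeries → Matrix
  riordan g f n k = (g ⋆ pow f k) n

  quasiRiordan : PowerSeries → PowerSeries → Matrix
  quasiRiordan g f n zero    = g n
  quasiRiordan g f n (suc j) = shift j f n

  oplus1 : Matrix → Matrix
  oplus1 M zero    zero    = 1#
  oplus1 M zero    (suc k) = 0#
  oplus1 M (suc n) zero    = 0#
  oplus1 M (suc n) (suc k) = M n k

  -- Product A B of infinite matrices where A is lower triangular
  -- (A n m = 0 for m > n), so (A B)_{n,k} = Σ_{m=0}^{n} A_{n,m} B_{m,k}.
  _⊗_ : Matrix → Matrix → Matrix
  (A ⊗ B) n k = sumBelow (λ m → A n m * B m k) (suc n)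

-- Column 0 of both sides is g. For column k + 1 the right-hand side is
-- Σ_{j<n} f_{n-j} d_{j,k}, which is [t^n] (g f^k) f with the term f_0 d_{n,k}
-- dropped; that term vanishes since f(0) = 0, and (g f^k) f = g f^(k+1)
-- because the Cauchy product is commutative and associative.
{-# OPTIONS --safe #-}
module Submission where

open import Defs
open import Level using (Level)
open import Data.Nat using (ℕ; zero; suc; _∸_; _≤_; _<_; z≤n; s≤s)
import Data.Nat as ℕ
import Data.Nat.Properties as ℕ
open import Data.Nat.Properties
  using (∸-+-assoc; +-∸-assoc; n∸n≡0; m∸[m∸n]≡n; ≤-pred; n<1+n; m<n⇒m<1+n)
open import Relation.Nullary using (¬_)
open import Relation.Binary.PropositionalEquality as ≡ using (_≡_)
open import Algebra.Bundles using (CommutativeRing)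
import Algebra.Properties.CommutativeSemigroup as CommutativeSemigroupProperties
import Relation.Binary.Reasoning.Setoid as SetoidReasoning

∸-∸-comm : ∀ m n o → m ∸ n ∸ o ≡ m ∸ o ∸ n
∸-∸-comm m n o = begin
  m ∸ n ∸ o     ≡⟨ ∸-+-assoc m n o ⟩
  m ∸ (n ℕ.+ o) ≡⟨ ≡.cong (m ∸_) (ℕ.+-comm n o) ⟩
  m ∸ (o ℕ.+ n) ≡⟨ ∸-+-assoc m o n ⟨
  m ∸ o ∸ n     ∎
  where open ≡.≡-Reasoning

module PowerSeriesProperties {c ℓ : Level} (R : CommutativeRing c ℓ) where
  open CommutativeRing R hiding (zero)
  open Series R
  open SetoidReasoning setoid
  open CommutativeSemigroupProperties +-commutativeSemigroup using (interchange)
  open CommutativeSemigroupProperties *-commutativeSemigroup using (x∙yz≈y∙xz)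

  infix 4 _≋_
  _≋_ : PowerSeries → PowerSeries → Set ℓ
  a ≋ b = ∀ n → a n ≈ b n

  sumBelow-cong : ∀ n {a b : ℕ → Carrier} →
    (∀ i → i < n → a i ≈ b i) → sumBelow a n ≈ sumBelow b n
  sumBelow-cong zero    _   = refl
  sumBelow-cong (suc n) a≈b =
    +-cong (sumBelow-cong n (λ i i<n → a≈b i (m<n⇒m<1+n i<n))) (a≈b n (n<1+n n))

  sumBelow-zero : ∀ n {a : ℕ → Carrier} → (∀ i → i < n → a i ≈ 0#) → sumBelow a n ≈ 0#
  sumBelow-zero zero    _   = refl
  sumBelow-zero (suc n) a≈0 =
    trans (+-cong (sumBelow-zero n (λ i i<n → a≈0 i (m<n⇒m<1+n i<n))) (a≈0 n (n<1+n n)))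
          (+-identityˡ 0#)

  sumBelow-suc : ∀ n (a : ℕ → Carrier) →
    sumBelow a (suc n) ≈ a 0 + sumBelow (λ i → a (suc i)) n
  sumBelow-suc zero    a = +-comm 0# (a 0)
  sumBelow-suc (suc n) a = begin
    sumBelow a (suc n) + a (suc n)                       ≈⟨ +-congʳ (sumBelow-suc n a) ⟩
    (a 0 + sumBelow (λ i → a (suc i)) n) + a (suc n)     ≈⟨ +-assoc _ _ _ ⟩
    a 0 + (sumBelow (λ i → a (suc i)) n + a (suc n))     ∎

  sumBelow-suc-∸ : ∀ (a : ℕ → Carrier) {i n} → i ≤ n →
    sumBelow a (suc n ∸ i) ≡ sumBelow a (n ∸ i) + a (n ∸ i)
  sumBelow-suc-∸ a i≤n = ≡.cong (sumBelow a) (+-∸-assoc 1 i≤n)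

  sumBelow-distrib-+ : ∀ n (a b : ℕ → Carrier) →
    sumBelow (λ i → a i + b i) n ≈ sumBelow a n + sumBelow b n
  sumBelow-distrib-+ zero    a b = sym (+-identityˡ 0#)
  sumBelow-distrib-+ (suc n) a b =
    trans (+-congʳ (sumBelow-distrib-+ n a b)) (interchange _ _ _ _)

  *-distribˡ-sumBelow : ∀ n x (a : ℕ → Carrier) →
    x * sumBelow a n ≈ sumBelow (λ i → x * a i) n
  *-distribˡ-sumBelow zero    x a = zeroʳ x
  *-distribˡ-sumBelow (suc n) x a =
    trans (distribˡ x _ _) (+-congʳ (*-distribˡ-sumBelow n x a))

  sumBelow-reverse : ∀ n (a : ℕ → Carrier) → sumBelow a n ≈ sumBelow (λ i → a (n ∸ suc i)) n
  sumBelow-reverse zero    a = refl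
  sumBelow-reverse (suc n) a = begin
    sumBelow a n + a n                       ≈⟨ +-comm _ _ ⟩
    a n + sumBelow a n                       ≈⟨ +-congˡ (sumBelow-reverse n a) ⟩
    a n + sumBelow (λ i → a (n ∸ suc i)) n   ≈⟨ sumBelow-suc n (λ i → a (n ∸ i)) ⟨
    sumBelow (λ i → a (n ∸ i)) (suc n)       ∎

  sumBelow-triangle-suc : ∀ n (Y : ℕ → ℕ → Carrier) →
    sumBelow (λ i → sumBelow (Y i) (suc n ∸ i)) (suc n)
      ≈ sumBelow (λ i → sumBelow (Y i) (n ∸ i)) n + sumBelow (λ i → Y i (n ∸ i)) (suc n)
  sumBelow-triangle-suc n Y = begin
    sumBelow (λ i → sumBelow (Y i) (suc n ∸ i)) (suc n)
      ≈⟨ sumBelow-cong (suc n) (λ i i<1+n → reflexive (sumBelow-suc-∸ (Y i) (≤-pred i<1+n))) ⟩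
    sumBelow (λ i → sumBelow (Y i) (n ∸ i) + Y i (n ∸ i)) (suc n)
      ≈⟨ sumBelow-distrib-+ (suc n) _ _ ⟩
    sumBelow (λ i → sumBelow (Y i) (n ∸ i)) n + sumBelow (Y n) (n ∸ n)
      + sumBelow (λ i → Y i (n ∸ i)) (suc n)
      ≈⟨ +-congʳ (+-congˡ (reflexive (≡.cong (sumBelow (Y n)) (n∸n≡0 n)))) ⟩
    sumBelow (λ i → sumBelow (Y i) (n ∸ i)) n + 0#
      + sumBelow (λ i → Y i (n ∸ i)) (suc n)
      ≈⟨ +-congʳ (+-identityʳ _) ⟩
    sumBelow (λ i → sumBelow (Y i) (n ∸ i)) n + sumBelow (λ i → Y i (n ∸ i)) (suc n) ∎

  -- Both sides grow by the anti-diagonal {i + j = n}, traversed in opposite directions.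
  sumBelow-triangle-swap : ∀ n (Y : ℕ → ℕ → Carrier) →
    sumBelow (λ i → sumBelow (Y i) (n ∸ i)) n
      ≈ sumBelow (λ j → sumBelow (λ i → Y i j) (n ∸ j)) n
  sumBelow-triangle-swap zero    Y = refl
  sumBelow-triangle-swap (suc n) Y = begin
    sumBelow (λ i → sumBelow (Y i) (suc n ∸ i)) (suc n)
      ≈⟨ sumBelow-triangle-suc n Y ⟩
    sumBelow (λ i → sumBelow (Y i) (n ∸ i)) n + sumBelow (λ i → Y i (n ∸ i)) (suc n)
      ≈⟨ +-cong (sumBelow-triangle-swap n Y) (sumBelow-reverse (suc n) _) ⟩
    sumBelow (λ j → sumBelow (λ i → Y i j) (n ∸ j)) n
      + sumBelow (λ j → Y (n ∸ j) (n ∸ (n ∸ j))) (suc n)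
      ≈⟨ +-congˡ (sumBelow-cong (suc n) (λ j j<1+n →
           reflexive (≡.cong (Y (n ∸ j)) (m∸[m∸n]≡n (≤-pred j<1+n))))) ⟩
    sumBelow (λ j → sumBelow (λ i → Y i j) (n ∸ j)) n + sumBelow (λ j → Y (n ∸ j) j) (suc n)
      ≈⟨ sumBelow-triangle-suc n (λ j i → Y i j) ⟨
    sumBelow (λ j → sumBelow (λ i → Y i j) (suc n ∸ j)) (suc n) ∎

  ⋆-cong : ∀ {a a′ b b′} → a ≋ a′ → b ≋ b′ → a ⋆ b ≋ a′ ⋆ b′
  ⋆-cong a≋a′ b≋b′ n = sumBelow-cong (suc n) (λ i _ → *-cong (a≋a′ i) (b≋b′ (n ∸ i)))

  ⋆-comm : ∀ a b → a ⋆ b ≋ b ⋆ a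
  ⋆-comm a b n = begin
    sumBelow (λ i → a i * b (n ∸ i)) (suc n)               ≈⟨ sumBelow-reverse (suc n) _ ⟩
    sumBelow (λ i → a (n ∸ i) * b (n ∸ (n ∸ i))) (suc n)
      ≈⟨ sumBelow-cong (suc n) (λ i i<1+n →
           trans (*-comm _ _) (*-congʳ (reflexive (≡.cong b (m∸[m∸n]≡n (≤-pred i<1+n)))))) ⟩
    sumBelow (λ i → b i * a (n ∸ i)) (suc n)               ∎

  ⋆-identityˡ : ∀ a → one ⋆ a ≋ a
  ⋆-identityˡ a n = begin
    (one ⋆ a) n                                         ≈⟨ sumBelow-suc n _ ⟩
    1# * a n + sumBelow (λ i → 0# * a (n ∸ suc i)) n
      ≈⟨ +-cong (*-identityˡ _) (sumBelow-zero n (λ i _ → zeroˡ _)) ⟩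
    a n + 0#                                            ≈⟨ +-identityʳ _ ⟩
    a n                                                 ∎

  ⋆-identityʳ : ∀ a → a ⋆ one ≋ a
  ⋆-identityʳ a n = trans (⋆-comm a one n) (⋆-identityˡ a n)

  ⋆-⋆-as-triangle : ∀ a b c n →
    (a ⋆ (b ⋆ c)) n ≈ sumBelow (λ i → sumBelow (λ j → a i * (b j * c (n ∸ i ∸ j))) (suc n ∸ i)) (suc n)
  ⋆-⋆-as-triangle a b c n = sumBelow-cong (suc n) λ i i<1+n →
    trans (*-distribˡ-sumBelow (suc (n ∸ i)) (a i) _)
          (reflexive (≡.cong (sumBelow _) (≡.sym (+-∸-assoc 1 (≤-pred i<1+n)))))

  ⋆-assoc : ∀ a b c → (a ⋆ b) ⋆ c ≋ a ⋆ (b ⋆ c)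
  ⋆-assoc a b c n = begin
    ((a ⋆ b) ⋆ c) n                                     ≈⟨ ⋆-comm (a ⋆ b) c n ⟩
    (c ⋆ (a ⋆ b)) n                                     ≈⟨ ⋆-⋆-as-triangle c a b n ⟩
    sumBelow (λ l → sumBelow (λ j → c l * (a j * b (n ∸ l ∸ j))) (suc n ∸ l)) (suc n)
      ≈⟨ sumBelow-triangle-swap (suc n) _ ⟩
    sumBelow (λ j → sumBelow (λ l → c l * (a j * b (n ∸ l ∸ j))) (suc n ∸ j)) (suc n)
      ≈⟨ sumBelow-cong (suc n) (λ j _ → sumBelow-cong (suc n ∸ j) (λ l _ →
           trans (x∙yz≈y∙xz _ _ _) (*-congˡ (*-congˡ (reflexive (≡.cong b (∸-∸-comm n l j))))))) ⟩
    sumBelow (λ j → sumBelow (λ l → a j * (c l * b (n ∸ j ∸ l))) (suc n ∸ j)) (suc n)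
      ≈⟨ ⋆-⋆-as-triangle a c b n ⟨
    (a ⋆ (c ⋆ b)) n                                     ≈⟨ ⋆-cong (λ _ → refl) (⋆-comm c b) n ⟩
    (a ⋆ (b ⋆ c)) n                                     ∎

  ⋆-init : ∀ a b n → b 0 ≈ 0# → (a ⋆ b) n ≈ sumBelow (λ i → a i * b (n ∸ i)) n
  ⋆-init a b n b0≈0 = begin
    sumBelow (λ i → a i * b (n ∸ i)) n + a n * b (n ∸ n)
      ≈⟨ +-congˡ (*-congˡ (trans (reflexive (≡.cong b (n∸n≡0 n))) b0≈0)) ⟩
    sumBelow (λ i → a i * b (n ∸ i)) n + a n * 0#    ≈⟨ +-congˡ (zeroʳ _) ⟩
    sumBelow (λ i → a i * b (n ∸ i)) n + 0#          ≈⟨ +-identityʳ _ ⟩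
    sumBelow (λ i → a i * b (n ∸ i)) n               ∎

  shift-≤ : ∀ a {j n} → j ≤ n → shift j a n ≡ a (n ∸ j)
  shift-≤ a z≤n       = ≡.refl
  shift-≤ a (s≤s j≤n) = shift-≤ a j≤n

  ⊗-oplus1-zero : ∀ A M n → (A ⊗ oplus1 M) n 0 ≈ A n 0
  ⊗-oplus1-zero A M n = begin
    (A ⊗ oplus1 M) n 0                                ≈⟨ sumBelow-suc n _ ⟩
    A n 0 * 1# + sumBelow (λ j → A n (suc j) * 0#) n
      ≈⟨ +-cong (*-identityʳ _) (sumBelow-zero n (λ j _ → zeroʳ _)) ⟩
    A n 0 + 0#                                        ≈⟨ +-identityʳ _ ⟩
    A n 0                                             ∎

  ⊗-oplus1-suc : ∀ A M n k →
    (A ⊗ oplus1 M) n (suc k) ≈ sumBelow (λ j → A n (suc j) * M j k) n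
  ⊗-oplus1-suc A M n k = begin
    (A ⊗ oplus1 M) n (suc k)                                   ≈⟨ sumBelow-suc n _ ⟩
    A n 0 * 0# + sumBelow (λ j → A n (suc j) * M j k) n        ≈⟨ +-congʳ (zeroʳ _) ⟩
    0# + sumBelow (λ j → A n (suc j) * M j k) n                ≈⟨ +-identityˡ _ ⟩
    sumBelow (λ j → A n (suc j) * M j k) n                     ∎

theorem2p4 : {c ℓ : Level} (R : CommutativeRing c ℓ) →
    let open CommutativeRing R in
    let open Series R in
    (g f : PowerSeries) →
    g 0 ≈ 1# → f 0 ≈ 0# → ¬ (f 1 ≈ 0#) →
    (n k : ℕ) →
    riordan g f n k ≈ (quasiRiordan g f ⊗ oplus1 (riordan g f)) n k
theorem2p4 R g f _ f0≈0 _ n = column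
  where
  open CommutativeRing R hiding (zero)
  open Series R
  open PowerSeriesProperties R
  open SetoidReasoning setoid

  column : ∀ k → riordan g f n k ≈ (quasiRiordan g f ⊗ oplus1 (riordan g f)) n k
  column zero    = trans (⋆-identityʳ g n) (sym (⊗-oplus1-zero (quasiRiordan g f) (riordan g f) n))
  column (suc k) = begin
    (g ⋆ (f ⋆ pow f k)) n                  ≈⟨ ⋆-cong (λ _ → refl) (⋆-comm f (pow f k)) n ⟩
    (g ⋆ (pow f k ⋆ f)) n                  ≈⟨ ⋆-assoc g (pow f k) f n ⟨
    ((g ⋆ pow f k) ⋆ f) n                  ≈⟨ ⋆-init (g ⋆ pow f k) f n f0≈0 ⟩
    sumBelow (λ j → riordan g f j k * f (n ∸ j)) n
      ≈⟨ sumBelow-cong n (λ j j<n →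
           trans (*-comm _ _) (*-congʳ (reflexive (≡.sym (shift-≤ f (m<n⇒m<1+n j<n)))))) ⟩
    sumBelow (λ j → quasiRiordan g f n (suc j) * riordan g f j k) n
      ≈⟨ ⊗-oplus1-suc (quasiRiordan g f) (riordan g f) n k ⟨
    (quasiRiordan g f ⊗ oplus1 (riordan g f)) n (suc k) ∎
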